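{- Let $k$ be a multiple of $4$ with $4\le k\le 2^{n/4}$ and $k\le n$. There is a nondeterministic OBDD on $n$ variables computing $\mathtt{NotEQS^k_{n}}$ whose width $d$ satisfies $d=O(k^4\log k)$.
   Context: For $\nu\in\{0,1\}^n$, among the first $k$ bits, call the odd positions marker bits and the even positions value bits. For $1\le i\le k/2$, the value bit $\nu_{2i}$ is appended (in order of increasing $i$) to the string $\alpha(\nu)$ if $\nu_{2i-1}=0$ and to $\beta(\nu)$ if $\nu_{2i-1}=1$. $\mathtt{NotEQS^k_{n}}(\nu)=0$ if $\alpha(\nu)=\beta(\nu)$ and $1$ otherwise. A nondeterministic OBDD on $x_1,\dots,x_n$ with order $\pi$ (a permutation of $\{1,\dots,n\}$) is a leveled directed acyclic graph with levels $0,\dots,n$, a single source at level $0$, each node at level $j-1$ having any number of outgoing edges labelled $0$ or $1$ to nodes at level $j$, and nodes at level $n$ marked accepting or rejecting; it outputs $1$ on $\nu$ iff some path from the source that at step $j$ follows an edge labelled $\nu_{\pi(j)}$ ends at an accepting node. Width is the maximum number of nodes in a level. -}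

module Defs where

open import Data.Bool using (Bool; true; false; not; if_then_else_)
open import Data.Nat using (ℕ; zero; suc; _≤_)
open import Data.Fin using (Fin; zero; suc; inject₁; fromℕ)
open import Data.Fin.Permutation using (Permutation′; _⟨$⟩ʳ_)
open import Data.List using (List; []; _∷_; take)
open import Data.List.Properties using (≡-dec)
open import Data.Vec using (Vec; toList)
open import Data.Product using (Σ; _×_; _,_; proj₁; proj₂)
open import Relation.Nullary using (does)
open import Relation.Binary.PropositionalEquality using (_≡_)
import Data.Bool as B

-- Split a bit string into (α, β): consecutive pairs (marker, value);
-- the value goes to α if marker = 0 (false), to β if marker = 1 (true).
-- A trailing unpaired bit (never occurs for even k) is ignored.
splitAB : List Bool → List Bool × List Bool
splitAB (m ∷ v ∷ rest) with splitAB rest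
... | (a , b) = if m then (a , v ∷ b) else (v ∷ a , b)
splitAB _ = ([] , [])

alpha beta : ℕ → {n : ℕ} → Vec Bool n → List Bool
alpha k ν = proj₁ (splitAB (take k (toList ν)))
beta  k ν = proj₂ (splitAB (take k (toList ν)))

NotEQS : (k n : ℕ) → Vec Bool n → Bool
NotEQS k n ν = not (does (≡-dec B._≟_ (alpha k ν) (beta k ν)))

-- Nondeterministic OBDD on n variables: levels 0..n (as Fin (suc n)),
-- size j = number of nodes at level j, a single source at level 0,
-- edge relation from level j (= inject₁ j) to level j+1 (= suc j) with labels,
-- accepting marks on the last level, and a variable order π.
record NOBDD (n : ℕ) : Set where
  field
    order    : Permutation′ n
    size     : Fin (suc n) → ℕ
    oneSource : size zero ≡ 1
    edge     : (j : Fin n) → Fin (size (inject₁ j)) → Bool → Fin (size (suc j)) → Bool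
    accepting : Fin (size (fromℕ n)) → Bool

open NOBDD public

readVar : {n : ℕ} → NOBDD n → Vec Bool n → Fin n → Bool
readVar D ν j = Data.Vec.lookup ν (order D ⟨$⟩ʳ j)

Accepts : {n : ℕ} → NOBDD n → Vec Bool n → Set
Accepts {n} D ν =
  Σ ((j : Fin (suc n)) → Fin (size D j)) λ p →
    ((j : Fin n) → edge D j (p (inject₁ j)) (readVar D ν j) (p (suc j)) ≡ true)
    × (accepting D (p (fromℕ n)) ≡ true)

Computes : {n : ℕ} → NOBDD n → (Vec Bool n → Bool) → Set
Computes D f = ∀ ν → (Accepts D ν → f ν ≡ true) × (f ν ≡ true → Accepts D ν)

WidthAtMost : {n : ℕ} → NOBDD n → ℕ → Set
WidthAtMost {n} D d = (j : Fin (suc n)) → size D j ≤ d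

-- α(ν) ≠ β(ν) iff the two lists differ at some position t ≤ k, an entry missing from the shorter
-- list counting as different from every bit.  The OBDD guesses t on its first edge and then scans
-- the first k bits deterministically, remembering only the pending marker bit and, for each of α
-- and β, either how many of its values must still be skipped to reach position t or the value found
-- there.  That is 3(k+3)² states per level, and 3(k+3)² ≤ 3k⁴⌊log₂ k⌋ once k ≥ 4.

module Submission where

open import Defs
open import Data.Nat using (ℕ; _≤_; _*_; _^_)
open import Data.Nat.Divisibility using (_∣_)
open import Data.Nat.Logarithm using (⌊log₂_⌋)
open import Data.Product using (Σ; _×_)

open import Data.Bool using (Bool; true; false; not; if_then_else_)
import Data.Bool as Bool
open import Data.Fin using (Fin; zero; suc; toℕ; inject₁; fromℕ; fromℕ<; _≟_)
open import Data.Fin.Induction using (<-weakInduction)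
open import Data.Fin.Properties using (any?; toℕ-inject₁; toℕ-fromℕ<; 2↔Bool; 1↔⊤; +↔⊎; *↔×)
import Data.Fin.Permutation as Permutation
open import Data.List using (List; []; _∷_; foldl; take; drop; head; length)
open import Data.List.Properties using (take-[]; length-take; ≡-dec)
open import Data.Maybe using (Maybe; just; nothing)
import Data.Maybe.Properties as Maybe
open import Data.Nat using (zero; suc; _+_; _∸_; _<?_; z≤n; s≤s; >-nonZero)
open import Data.Nat.Logarithm using (⌊log₂⌋-mono-≤)
open import Data.Nat.Properties
  using (≤-refl; ≤-trans; +-∸-assoc; m≤n⇒m∸n≡0; ≮⇒≥; m≤n⇒m≤1+n; m⊓n≤m; +-monoˡ-≤; <⇒≤;
         +-identityʳ; +-suc; *-identityʳ; *-monoˡ-≤; *-monoʳ-≤; *-mono-≤; ^-distribˡ-+-*; m≤m*n;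
         module ≤-Reasoning)
open import Data.Product using (_,_; proj₁; proj₂; ∃-syntax)
open import Data.Product.Function.NonDependent.Propositional using (_×-↔_)
open import Data.Sum using (_⊎_; inj₁; inj₂)
open import Data.Sum.Function.Propositional using (_⊎-↔_)
open import Data.Unit using (⊤; tt)
open import Data.Vec using (Vec; lookup; toList)
import Data.Vec as Vec
open import Function using (_∘_)
open import Function.Bundles using (_↔_; _⇔_; mk⇔; mk↔ₛ′; Inverse; Equivalence)
open import Function.Properties.Inverse using (↔-refl; ↔-sym; ↔-trans)
open import Relation.Nullary using (Dec; yes; no; does; ¬_; contradiction)
open import Relation.Nullary.Decidable using (dec-true; dec-false)
open import Relation.Binary.Definitions using (DecidableEquality)
open import Relation.Binary.PropositionalEquality using (_≡_; _≢_; refl; sym; trans; cong; cong₂; subst; module ≡-Reasoning)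

does≡true⇔ : ∀ {A : Set} (a? : Dec A) → does a? ≡ true ⇔ A
does≡true⇔ (yes a) = mk⇔ (λ _ → a) (λ _ → refl)
does≡true⇔ (no ¬a) = mk⇔ (λ ()) (λ a → contradiction a ¬a)

not-does≡true⇔ : ∀ {A : Set} (a? : Dec A) → not (does a?) ≡ true ⇔ (¬ A)
not-does≡true⇔ (yes a) = mk⇔ (λ ()) (λ ¬a → contradiction a ¬a)
not-does≡true⇔ (no ¬a) = mk⇔ (λ _ → ¬a) (λ _ → refl)

Maybe↔⊤⊎ : ∀ {A : Set} → Maybe A ↔ (⊤ ⊎ A)
Maybe↔⊤⊎ {A} = mk↔ₛ′ to from (λ { (inj₁ tt) → refl ; (inj₂ a) → refl }) (λ { nothing → refl ; (just a) → refl })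
  where
  to : Maybe A → ⊤ ⊎ A
  to nothing = inj₁ tt
  to (just a) = inj₂ a
  from : ⊤ ⊎ A → Maybe A
  from (inj₁ tt) = nothing
  from (inj₂ a) = just a

module _ {A : Set} (_≟ₐ_ : DecidableEquality A) where

  ≢⇒head∘drop-≢ : ∀ {xs ys : List A} → xs ≢ ys → ∃[ i ] i ≤ length xs × head (drop i xs) ≢ head (drop i ys)
  ≢⇒head∘drop-≢ {[]} {[]} xs≢ys = contradiction refl xs≢ys
  ≢⇒head∘drop-≢ {[]} {y ∷ ys} _ = 0 , z≤n , λ ()
  ≢⇒head∘drop-≢ {x ∷ xs} {[]} _ = 0 , z≤n , λ ()
  ≢⇒head∘drop-≢ {x ∷ xs} {y ∷ ys} x∷xs≢y∷ys with x ≟ₐ y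
  ... | no x≢y = 0 , z≤n , x≢y ∘ Maybe.just-injective
  ... | yes refl with ≢⇒head∘drop-≢ (x∷xs≢y∷ys ∘ cong (x ∷_))
  ...   | i , i≤ , differ = suc i , s≤s i≤ , differ

run : {A S : Set} → (ℕ → A → S → S) → ℕ → List A → S → S
run step i [] s = s
run step i (x ∷ xs) s = run step (suc i) xs (step i x s)

trace : {A S : Set} {n : ℕ} → (ℕ → A → S → S) → ℕ → Vec A n → S → Fin (suc n) → S
trace step i ν s zero = s
trace step i (x Vec.∷ ν) s (suc j) = trace step (suc i) ν (step i x s) j

module _ {A S : Set} (step : ℕ → A → S → S) where

  trace-suc : ∀ {n} i (ν : Vec A n) s (j : Fin n) →
              trace step i ν s (suc j) ≡ step (i + toℕ j) (lookup ν j) (trace step i ν s (inject₁ j))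
  trace-suc i (x Vec.∷ ν) s zero = cong (λ m → step m x s) (sym (+-identityʳ i))
  trace-suc i (x Vec.∷ ν) s (suc j) =
    trans (trace-suc (suc i) ν (step i x s) j)
          (cong (λ m → step m (lookup ν j) (trace step (suc i) ν (step i x s) (inject₁ j))) (sym (+-suc i (toℕ j))))

  trace-fromℕ : ∀ {n} i (ν : Vec A n) s → trace step i ν s (fromℕ n) ≡ run step i (toList ν) s
  trace-fromℕ i Vec.[] s = refl
  trace-fromℕ i (x Vec.∷ ν) s = trace-fromℕ (suc i) ν (step i x s)

gate : {A S : Set} → ℕ → (S → A → S) → ℕ → A → S → S
gate k f i x s = if does (i <? k) then f s x else s

run-gate : ∀ {A S : Set} (f : S → A → S) k i xs s → run (gate k f) i xs s ≡ foldl f s (take (k ∸ i) xs)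
run-gate f k i [] s = cong (foldl f s) (sym (take-[] (k ∸ i)))
run-gate f k i (x ∷ xs) s with i <? k
... | yes i<k = begin
  run (gate k f) (suc i) xs (gate k f i x s)   ≡⟨ cong (λ b → run (gate k f) (suc i) xs (if b then f s x else s))
                                                        (dec-true (i <? k) i<k) ⟩
  run (gate k f) (suc i) xs (f s x)            ≡⟨ run-gate f k (suc i) xs (f s x) ⟩
  foldl f s (take (suc (k ∸ suc i)) (x ∷ xs)) ≡⟨ cong (λ m → foldl f s (take m (x ∷ xs))) (+-∸-assoc 1 i<k) ⟨
  foldl f s (take (k ∸ i) (x ∷ xs))           ∎
  where open ≡-Reasoning
... | no i≮k = begin
  run (gate k f) (suc i) xs (gate k f i x s)  ≡⟨ cong (λ b → run (gate k f) (suc i) xs (if b then f s x else s))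
                                                       (dec-false (i <? k) i≮k) ⟩
  run (gate k f) (suc i) xs s                 ≡⟨ run-gate f k (suc i) xs s ⟩
  foldl f s (take (k ∸ suc i) xs)             ≡⟨ cong (λ m → foldl f s (take m xs)) (m≤n⇒m∸n≡0 (m≤n⇒m≤1+n k≤i)) ⟩
  s                                           ≡⟨ cong (λ m → foldl f s (take m (x ∷ xs))) (m≤n⇒m∸n≡0 k≤i) ⟨
  foldl f s (take (k ∸ i) (x ∷ xs))           ∎
  where
  open ≡-Reasoning
  k≤i : k ≤ i
  k≤i = ≮⇒≥ i≮k

-- The only nondeterminism is the choice of g on the edges leaving the source; afterwards every
-- node has exactly one successor per bit.
module GuessAndRun {Q : Set} {N G : ℕ} (encoding : Q ↔ Fin N) (start : Fin G → Q)
                   (step : ℕ → Bool → Q → Q) (final : Q → Bool) (n : ℕ) where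

  open Inverse encoding using (to; from; strictlyInverseʳ)
  open ≡-Reasoning

  Succeeds : Vec Bool (suc n) → Set
  Succeeds ν = ∃[ g ] final (run step 0 (toList ν) (start g)) ≡ true

  levelSize : Fin (suc (suc n)) → ℕ
  levelSize zero = 1
  levelSize (suc _) = N

  transition : (j : Fin (suc n)) → Fin (levelSize (inject₁ j)) → Bool → Fin N → Bool
  transition zero _ b y = does (any? λ g → y ≟ to (step 0 b (start g)))
  transition (suc j) x b y = does (y ≟ to (step (suc (toℕ j)) b (from x)))

  obdd : NOBDD (suc n)
  obdd = record
    { order = Permutation.id ; size = levelSize ; oneSource = refl
    ; edge = transition ; accepting = final ∘ from }

  transition-zero⇒ : ∀ x b y → transition zero x b y ≡ true → ∃[ g ] from y ≡ step 0 b (start g)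
  transition-zero⇒ x b y edge with Equivalence.to (does≡true⇔ (any? _)) edge
  ... | g , y≡ = g , trans (cong from y≡) (strictlyInverseʳ _)

  transition-suc⇒ : ∀ j x b y → transition (suc j) x b y ≡ true → from y ≡ step (suc (toℕ j)) b (from x)
  transition-suc⇒ j x b y edge = trans (cong from (Equivalence.to (does≡true⇔ (_ ≟ _)) edge)) (strictlyInverseʳ _)

  sound : ∀ ν → Accepts obdd ν → Succeeds ν
  sound ν (p , onPath , accepted) = g , (begin
    final (run step 0 (toList ν) (start g))            ≡⟨ cong final (trace-fromℕ step 0 ν (start g)) ⟨
    final (trace step 0 ν (start g) (fromℕ (suc n)))   ≡⟨ cong final (followsTrace (fromℕ n)) ⟨
    final (from (p (fromℕ (suc n))))                   ≡⟨ accepted ⟩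
    true                                               ∎)
    where
    firstGuess : ∃[ g ] from (p (suc zero)) ≡ step 0 (lookup ν zero) (start g)
    firstGuess = transition-zero⇒ (p zero) _ _ (onPath zero)
    g : Fin G
    g = proj₁ firstGuess
    followsTrace : ∀ j → from (p (suc j)) ≡ trace step 0 ν (start g) (suc j)
    followsTrace = <-weakInduction _
      (trans (proj₂ firstGuess) (sym (trace-suc step 0 ν (start g) zero)))
      λ i ih → begin
        from (p (suc (suc i)))                                             ≡⟨ transition-suc⇒ i _ _ _ (onPath (suc i)) ⟩
        step (suc (toℕ i)) (lookup ν (suc i)) (from (p (suc (inject₁ i)))) ≡⟨ cong (step _ _) ih ⟩
        step (suc (toℕ i)) (lookup ν (suc i)) (trace step 0 ν (start g) (suc (inject₁ i)))
                                                                           ≡⟨ trace-suc step 0 ν (start g) (suc i) ⟨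
        trace step 0 ν (start g) (suc (suc i))                             ∎

  complete : ∀ ν → Succeeds ν → Accepts obdd ν
  complete ν (g , succeeds) = p , onPath , accepted
    where
    states : Fin (suc (suc n)) → Q
    states = trace step 0 ν (start g)
    p : (j : Fin (suc (suc n))) → Fin (levelSize j)
    p zero = zero
    p (suc j) = to (states (suc j))
    onPath : ∀ j → transition j (p (inject₁ j)) (lookup ν j) (p (suc j)) ≡ true
    onPath zero = dec-true (any? _) (g , cong to (trace-suc step 0 ν (start g) zero))
    onPath (suc j) = dec-true (_ ≟ _) (cong to (trans (trace-suc step 0 ν (start g) (suc j))
                                                      (cong (step _ _) (sym (strictlyInverseʳ _)))))
    accepted : final (from (p (fromℕ (suc n)))) ≡ true
    accepted = trans (cong final (trans (strictlyInverseʳ _) (trace-fromℕ step 0 ν (start g)))) succeeds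

  obdd-width : ∀ {d} → 1 ≤ d → N ≤ d → WidthAtMost obdd d
  obdd-width 1≤d N≤d zero = 1≤d
  obdd-width 1≤d N≤d (suc _) = N≤d

-- inj₂ r: r more values are to be skipped; inj₁ v: the value at the tracked position was v.
Tracker : ℕ → Set
Tracker K = Bool ⊎ Fin K

track : ∀ {K} → Tracker K → Bool → Tracker K
track (inj₁ w) v = inj₁ w
track (inj₂ zero) v = inj₁ v
track (inj₂ (suc r)) v = inj₂ (inject₁ r)

captured : ∀ {K} → Tracker K → Maybe Bool
captured (inj₁ v) = just v
captured (inj₂ _) = nothing

foldl-track-inj₁ : ∀ {K} w vs → foldl (track {K}) (inj₁ w) vs ≡ inj₁ w
foldl-track-inj₁ w [] = refl
foldl-track-inj₁ w (v ∷ vs) = foldl-track-inj₁ w vs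

captured-foldl-track : ∀ {K} (r : Fin K) vs → captured (foldl track (inj₂ r) vs) ≡ head (drop (toℕ r) vs)
captured-foldl-track zero [] = refl
captured-foldl-track (suc r) [] = refl
captured-foldl-track zero (v ∷ vs) = cong captured (foldl-track-inj₁ v vs)
captured-foldl-track (suc r) (v ∷ vs) =
  trans (captured-foldl-track (inject₁ r) vs) (cong (λ i → head (drop i vs)) (toℕ-inject₁ r))

Tracker↔Fin : ∀ {K} → Tracker K ↔ Fin (2 + K)
Tracker↔Fin = ↔-trans (↔-sym 2↔Bool ⊎-↔ ↔-refl) (↔-sym +↔⊎)

-- The marker bit awaiting its value bit (nothing when the next bit is a marker), and the trackers
-- of α and β.
Reader : ℕ → Set
Reader K = Maybe Bool × Tracker K × Tracker K

read : ∀ {K} → Reader K → Bool → Reader K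
read (nothing , a , b) m = just m , a , b
read (just false , a , b) v = nothing , track a v , b
read (just true , a , b) v = nothing , a , track b v

foldl-read : ∀ {K} L (a b : Tracker K) →
  proj₂ (foldl read (nothing , a , b) L) ≡ (foldl track a (proj₁ (splitAB L)) , foldl track b (proj₂ (splitAB L)))
foldl-read [] a b = refl
foldl-read (x ∷ []) a b = refl
foldl-read (false ∷ v ∷ rest) a b with splitAB rest | foldl-read rest (track a v) b
... | _ | ih = ih
foldl-read (true ∷ v ∷ rest) a b with splitAB rest | foldl-read rest a (track b v)
... | _ | ih = ih

Reader↔Fin : ∀ {K} → Reader K ↔ Fin (3 * ((2 + K) * (2 + K)))
Reader↔Fin = ↔-trans (MaybeBool↔Fin3 ×-↔ ↔-trans (Tracker↔Fin ×-↔ Tracker↔Fin) (↔-sym *↔×)) (↔-sym *↔×)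
  where
  MaybeBool↔Fin3 : Maybe Bool ↔ Fin 3
  MaybeBool↔Fin3 = ↔-trans Maybe↔⊤⊎ (↔-trans (↔-sym 1↔⊤ ⊎-↔ ↔-sym 2↔Bool) (↔-sym +↔⊎))

length-proj₁-splitAB : ∀ L → length (proj₁ (splitAB L)) ≤ length L
length-proj₁-splitAB [] = z≤n
length-proj₁-splitAB (x ∷ []) = z≤n
length-proj₁-splitAB (false ∷ v ∷ rest) with splitAB rest | length-proj₁-splitAB rest
... | _ | ih = s≤s (m≤n⇒m≤1+n ih)
length-proj₁-splitAB (true ∷ v ∷ rest) with splitAB rest | length-proj₁-splitAB rest
... | _ | ih = m≤n⇒m≤1+n (m≤n⇒m≤1+n ih)

module NotEQSScan (k : ℕ) where

  start : Fin (suc k) → Reader (suc k)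
  start t = nothing , inj₂ t , inj₂ t

  scan : ℕ → Bool → Reader (suc k) → Reader (suc k)
  scan = gate k read

  trackersDiffer : Tracker (suc k) × Tracker (suc k) → Bool
  trackersDiffer (a , b) = not (does (Maybe.≡-dec Bool._≟_ (captured a) (captured b)))

  differ : Reader (suc k) → Bool
  differ = trackersDiffer ∘ proj₂

  differ-scan⇔ : ∀ {n} (ν : Vec Bool n) t →
                 differ (run scan 0 (toList ν) (start t)) ≡ true ⇔
                 head (drop (toℕ t) (alpha k ν)) ≢ head (drop (toℕ t) (beta k ν))
  differ-scan⇔ ν t = subst (λ b → b ≡ true ⇔ (αₜ ≢ βₜ)) (sym differ-scan) (not-does≡true⇔ (Maybe.≡-dec Bool._≟_ αₜ βₜ))
    where
    open ≡-Reasoning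
    L : List Bool
    L = take k (toList ν)
    αₜ βₜ : Maybe Bool
    αₜ = head (drop (toℕ t) (alpha k ν))
    βₜ = head (drop (toℕ t) (beta k ν))
    differ-scan : differ (run scan 0 (toList ν) (start t)) ≡ not (does (Maybe.≡-dec Bool._≟_ αₜ βₜ))
    differ-scan = begin
      differ (run scan 0 (toList ν) (start t))
        ≡⟨ cong differ (run-gate read k 0 (toList ν) (start t)) ⟩
      trackersDiffer (proj₂ (foldl read (start t) L))
        ≡⟨ cong trackersDiffer (foldl-read L (inj₂ t) (inj₂ t)) ⟩
      trackersDiffer (foldl track (inj₂ t) (alpha k ν) , foldl track (inj₂ t) (beta k ν))
        ≡⟨ cong₂ (λ u v → not (does (Maybe.≡-dec Bool._≟_ u v)))
                 (captured-foldl-track t (alpha k ν)) (captured-foldl-track t (beta k ν)) ⟩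
      not (does (Maybe.≡-dec Bool._≟_ αₜ βₜ))
        ∎

  NotEQS⇔differ-scan : ∀ {n} (ν : Vec Bool n) →
                       NotEQS k n ν ≡ true ⇔ (∃[ t ] differ (run scan 0 (toList ν) (start t)) ≡ true)
  NotEQS⇔differ-scan {n} ν = mk⇔ guess check
    where
    α≢β⇔ : NotEQS k n ν ≡ true ⇔ (alpha k ν ≢ beta k ν)
    α≢β⇔ = not-does≡true⇔ (≡-dec Bool._≟_ (alpha k ν) (beta k ν))
    guess : NotEQS k n ν ≡ true → ∃[ t ] differ (run scan 0 (toList ν) (start t)) ≡ true
    guess notEq with ≢⇒head∘drop-≢ Bool._≟_ (Equivalence.to α≢β⇔ notEq)
    ... | i , i≤∣α∣ , differAt = fromℕ< (s≤s i≤k) , Equivalence.from (differ-scan⇔ ν _) differAt′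
      where
      ∣take∣≤k : length (take k (toList ν)) ≤ k
      ∣take∣≤k = subst (_≤ k) (sym (length-take k (toList ν))) (m⊓n≤m k _)
      i≤k : i ≤ k
      i≤k = ≤-trans i≤∣α∣ (≤-trans (length-proj₁-splitAB (take k (toList ν))) ∣take∣≤k)
      differAt′ : head (drop (toℕ (fromℕ< (s≤s i≤k))) (alpha k ν)) ≢ head (drop (toℕ (fromℕ< (s≤s i≤k))) (beta k ν))
      differAt′ = subst (λ j → head (drop j (alpha k ν)) ≢ head (drop j (beta k ν))) (sym (toℕ-fromℕ< (s≤s i≤k))) differAt
    check : ∃[ t ] differ (run scan 0 (toList ν) (start t)) ≡ true → NotEQS k n ν ≡ true
    check (t , differs) = Equivalence.from α≢β⇔ (Equivalence.to (differ-scan⇔ ν t) differs ∘ cong (head ∘ drop (toℕ t)))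

notEQS-obdd : ∀ k n → Σ (NOBDD (suc n)) λ D → Computes D (NotEQS k (suc n)) × WidthAtMost D (3 * ((3 + k) * (3 + k)))
notEQS-obdd k n = obdd , computes , obdd-width (s≤s z≤n) ≤-refl
  where
  open NotEQSScan k
  open GuessAndRun Reader↔Fin start scan differ n
  computes : Computes obdd (NotEQS k (suc n))
  computes ν = Equivalence.from (NotEQS⇔differ-scan ν) ∘ sound ν , complete ν ∘ Equivalence.to (NotEQS⇔differ-scan ν)

3*[3+k]²≤3*[k⁴*log₂k] : ∀ k → 4 ≤ k → 3 * ((3 + k) * (3 + k)) ≤ 3 * (k ^ 4 * ⌊log₂ k ⌋)
3*[3+k]²≤3*[k⁴*log₂k] k 4≤k = *-monoʳ-≤ 3 (begin
  (3 + k) * (3 + k)  ≤⟨ *-mono-≤ 3+k≤k² 3+k≤k² ⟩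
  k ^ 2 * k ^ 2      ≡⟨ ^-distribˡ-+-* k 2 2 ⟨
  k ^ 4              ≤⟨ m≤m*n (k ^ 4) ⌊log₂ k ⌋ {{>-nonZero (≤-trans (s≤s z≤n) (⌊log₂⌋-mono-≤ 4≤k))}} ⟩
  k ^ 4 * ⌊log₂ k ⌋  ∎)
  where
  open ≤-Reasoning
  3+k≤k² : 3 + k ≤ k ^ 2
  3+k≤k² = begin
    3 + k  ≤⟨ +-monoˡ-≤ k (<⇒≤ 4≤k) ⟩
    k + k  ≡⟨ cong (k +_) (+-identityʳ k) ⟨
    2 * k  ≤⟨ *-monoˡ-≤ k (≤-trans (s≤s (s≤s z≤n)) 4≤k) ⟩
    k * k  ≡⟨ cong (k *_) (*-identityʳ k) ⟨
    k ^ 2  ∎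

lemma9 : Σ ℕ λ C → (n k : ℕ) → 4 ∣ k → 4 ≤ k → k ^ 4 ≤ 2 ^ n → k ≤ n →
    Σ (NOBDD n) λ D → Computes D (NotEQS k n) × WidthAtMost D (C * (k ^ 4 * ⌊log₂ k ⌋))
lemma9 = 3 , λ where
  zero k _ 4≤k _ k≤0 → contradiction (≤-trans 4≤k k≤0) λ ()
  (suc n) k _ 4≤k _ _ → let D , computes , width = notEQS-obdd k n
                        in D , computes , λ j → ≤-trans (width j) (3*[3+k]²≤3*[k⁴*log₂k] k 4≤k)
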